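{- If $G$ and $H$ are nontrivial connected graphs such that $\iota(H)\geq 2$, then $\iota(G \circ H)=\gamma(G \circ H)=\gamma_t(G)$.
   Context: All graphs are finite and simple; nontrivial means at least two vertices. $G\circ H$ is the lexicographic product: vertex set $V(G)\times V(H)$, with $(g,h)$ adjacent to $(g_1,h_1)$ iff $gg_1\in E(G)$, or $g=g_1$ and $hh_1\in E(H)$. $\gamma$ is the domination number and $\gamma_t$ the total domination number. A set $A$ of vertices is isolating if no two vertices outside the closed neighborhood $N[A]$ are adjacent; $\iota$ is the minimum size of an isolating set. -}

module Defs where

open import Data.Nat using (ℕ; _≤_; _*_)
open import Data.Fin using (Fin; remQuot)
open import Data.Fin.Subset using (Subset; _∈_; _∉_; ∣_∣)
open import Data.Product using (Σ; ∃; _×_; _,_; proj₁; proj₂)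
open import Data.Sum using (_⊎_)
open import Relation.Nullary using (¬_)
open import Relation.Binary.PropositionalEquality using (_≡_)

record Graph (n : ℕ) : Set₁ where
  field
    Adj   : Fin n → Fin n → Set
    sym   : ∀ {u v} → Adj u v → Adj v u
    irrefl : ∀ {u} → ¬ Adj u u
open Graph public

Nontrivial : ∀ {n} → Graph n → Set
Nontrivial {n} _ = 2 ≤ n

data Reachable {n} (G : Graph n) : Fin n → Fin n → Set where
  here : ∀ {u} → Reachable G u u
  step : ∀ {u v w} → Adj G u v → Reachable G v w → Reachable G u w

Connected : ∀ {n} → Graph n → Set
Connected {n} G = ∀ (u v : Fin n) → Reachable G u v

-- Lexicographic product G ∘ H, vertex (g , h) encoded via remQuot into Fin (m * n).
lexAdj : ∀ {m n} → Graph m → Graph n → Fin (m * n) → Fin (m * n) → Set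
lexAdj {m} {n} G H x y =
  Adj G (proj₁ (remQuot n x)) (proj₁ (remQuot n y))
  ⊎ (proj₁ (remQuot {m} n x) ≡ proj₁ (remQuot n y)
     × Adj H (proj₂ (remQuot {m} n x)) (proj₂ (remQuot {m} n y)))

lexSym : ∀ {m n} (G : Graph m) (H : Graph n) {x y} → lexAdj G H x y → lexAdj G H y x
lexSym G H (Data.Sum.inj₁ a) = Data.Sum.inj₁ (sym G a)
lexSym G H (Data.Sum.inj₂ (e , a)) =
  Data.Sum.inj₂ (Relation.Binary.PropositionalEquality.sym e , sym H a)

lexIrrefl : ∀ {m n} (G : Graph m) (H : Graph n) {x} → ¬ lexAdj G H x x
lexIrrefl G H (Data.Sum.inj₁ a) = irrefl G a
lexIrrefl G H (Data.Sum.inj₂ (_ , a)) = irrefl H a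

_∘ₗ_ : ∀ {m n} → Graph m → Graph n → Graph (m * n)
G ∘ₗ H = record { Adj = lexAdj G H ; sym = lexSym G H ; irrefl = lexIrrefl G H }

InClosedNbhd : ∀ {n} → Graph n → Subset n → Fin n → Set
InClosedNbhd G A v = v ∈ A ⊎ ∃ λ a → a ∈ A × Adj G a v

Dominating : ∀ {n} → Graph n → Subset n → Set
Dominating G A = ∀ v → InClosedNbhd G A v

TotalDominating : ∀ {n} → Graph n → Subset n → Set
TotalDominating G A = ∀ v → ∃ λ a → a ∈ A × Adj G a v

Isolating : ∀ {n} → Graph n → Subset n → Set
Isolating G A = ∀ u v → ¬ InClosedNbhd G A u → ¬ InClosedNbhd G A v → ¬ Adj G u v

IsMinSize : ∀ {n} → (Subset n → Set) → ℕ → Set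
IsMinSize P k = (∃ λ S → P S × ∣ S ∣ ≡ k) × (∀ S → P S → k ≤ ∣ S ∣)

IsDominationNumber : ∀ {n} → Graph n → ℕ → Set
IsDominationNumber G = IsMinSize (Dominating G)

IsTotalDominationNumber : ∀ {n} → Graph n → ℕ → Set
IsTotalDominationNumber G = IsMinSize (TotalDominating G)

IsIsolationNumber : ∀ {n} → Graph n → ℕ → Set
IsIsolationNumber G = IsMinSize (Isolating G)

-- Upper bound: if D is a total dominating set of G and h is any vertex of H, then D × {h} is a
-- dominating, hence isolating, set of G ∘ H of size |D|.
-- Lower bound: let A isolate G ∘ H. If g ∈ V(G) has no G-neighbour carrying a vertex of A, then no
-- vertex of A sees the fibre {g} × V(H) from outside, so the trace of A on that fibre isolates H and
-- has at least ι(H) ≥ 2 vertices. The projection of A together with one G-neighbour of each such g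
-- is a total dominating set of G, and each such g is paid for by the second vertex of its fibre, so
-- this set has at most |A| vertices.
module Submission where

open import Defs
open import Data.Nat using (ℕ; _≤_)
open import Data.Product using (_×_)

open import Data.Bool using (Bool; true; false; _∧_; not)
open import Data.Empty using (⊥-elim)
open import Data.Fin using (Fin; zero; suc; combine; quotient; remainder; fromℕ<; _↑ˡ_; _↑ʳ_)
open import Data.Fin.Properties using (remQuot-combine; combine-remQuot)
open import Data.Fin.Subset using (Subset; _∈_; ∣_∣; ⁅_⁆)
open import Data.Fin.Subset.Properties using (x∈⁅x⁆; ∣⁅x⁆∣≡1; x∈p⇒∣p-x∣<∣p∣)
open import Data.Nat using (zero; suc; _+_; _*_; _<ᵇ_; z≤n; s≤s; _≤?_)
open import Data.Nat.Properties
  using (+-*-semiring; ≤-trans; ≤-reflexive; +-mono-≤; +-assoc; +-identityʳ; *-identityˡ; *-identityʳ;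
         m≤m+n; m≤n+m; module ≤-Reasoning)
open import Algebra.Properties.Semiring.Sum +-*-semiring
  using (sum; sum-syntax; sum-cong-≗; ∑-comm; ∑-distrib-+; *-distribˡ-sum; *-distribʳ-sum)
open import Data.Product using (∃; _,_; proj₁; proj₂)
open import Data.Sum using (inj₁; inj₂)
open import Data.Vec using ([]; _∷_; lookup; tabulate)
open import Data.Vec.Properties using (lookup∘tabulate; []=⇒lookup; lookup⇒[]=)
open import Function using (_∘_)
open import Relation.Nullary using (¬_; Dec; yes; no; does)
open import Relation.Nullary.Decidable using (decidable-stable; ¬¬-excluded-middle)
open import Relation.Binary.PropositionalEquality as ≡
  using (_≡_; refl; trans; cong; cong₂; subst; subst₂; module ≡-Reasoning)

χ : Bool → ℕ
χ true = 1
χ false = 0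

χ-∧ : ∀ b c → χ (b ∧ c) ≡ χ b * χ c
χ-∧ true c = ≡.sym (+-identityʳ (χ c))
χ-∧ false c = refl

term≤∑ : ∀ {n} (f : Fin n → ℕ) i → f i ≤ sum f
term≤∑ f zero = m≤m+n _ _
term≤∑ f (suc i) = ≤-trans (term≤∑ (f ∘ suc) i) (m≤n+m _ (f zero))

∑-mono-≤ : ∀ {n} {f g : Fin n → ℕ} → (∀ i → f i ≤ g i) → sum f ≤ sum g
∑-mono-≤ {zero} f≤g = z≤n
∑-mono-≤ {suc n} f≤g = +-mono-≤ (f≤g zero) (∑-mono-≤ (f≤g ∘ suc))

∑-↑ : ∀ a b (f : Fin (a + b) → ℕ) →
  sum f ≡ ∑[ i < a ] f (i ↑ˡ b) + ∑[ j < b ] f (a ↑ʳ j)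
∑-↑ zero b f = refl
∑-↑ (suc a) b f = trans (cong (f zero +_) (∑-↑ a b (f ∘ suc))) (≡.sym (+-assoc (f zero) _ _))

∑-combine : ∀ m n (f : Fin (m * n) → ℕ) →
  sum f ≡ ∑[ i < m ] ∑[ j < n ] f (combine i j)
∑-combine zero n f = refl
∑-combine (suc m) n f =
  trans (∑-↑ n (m * n) f) (cong (∑[ j < n ] f (j ↑ˡ (m * n)) +_) (∑-combine m n (f ∘ (n ↑ʳ_))))

∣p∣≡∑χ : ∀ {n} (p : Subset n) → ∣ p ∣ ≡ ∑[ i < n ] χ (lookup p i)
∣p∣≡∑χ [] = refl
∣p∣≡∑χ (true ∷ p) = cong suc (∣p∣≡∑χ p)
∣p∣≡∑χ (false ∷ p) = ∣p∣≡∑χ p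

∣tabulate∣≡∑χ : ∀ {n} (f : Fin n → Bool) → ∣ tabulate f ∣ ≡ ∑[ i < n ] χ (f i)
∣tabulate∣≡∑χ f = trans (∣p∣≡∑χ (tabulate f)) (sum-cong-≗ (cong χ ∘ lookup∘tabulate f))

∈-tabulate : ∀ {n} (f : Fin n → Bool) {i} → f i ≡ true → i ∈ tabulate f
∈-tabulate f {i} fi≡true = lookup⇒[]= i (tabulate f) (trans (lookup∘tabulate f i) fi≡true)

∈⇒1≤∣∣ : ∀ {n} {p : Subset n} {x} → x ∈ p → 1 ≤ ∣ p ∣
∈⇒1≤∣∣ x∈p = ≤-trans (s≤s z≤n) (x∈p⇒∣p-x∣<∣p∣ x∈p)

-- The total w-weight of the preimage of j under f.
push : ∀ {a b} → (Fin a → Fin b) → (Fin a → ℕ) → Fin b → ℕ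
push {a} f w j = ∑[ i < a ] (χ (lookup ⁅ f i ⁆ j) * w i)

∑-push : ∀ {a b} (f : Fin a → Fin b) (w : Fin a → ℕ) → sum (push f w) ≡ sum w
∑-push {a} {b} f w = begin
  ∑[ j < b ] ∑[ i < a ] (δ i j * w i)   ≡⟨ ∑-comm (λ i j → δ i j * w i) ⟨
  ∑[ i < a ] ∑[ j < b ] (δ i j * w i)   ≡⟨ sum-cong-≗ (λ i → *-distribʳ-sum (w i) (δ i)) ⟨
  ∑[ i < a ] (sum (δ i) * w i)          ≡⟨ sum-cong-≗ (λ i → cong (_* w i) (∑δ≡1 i)) ⟩
  ∑[ i < a ] (1 * w i)                  ≡⟨ sum-cong-≗ (λ i → *-identityˡ (w i)) ⟩
  sum w                                 ∎
  where
  open ≡-Reasoning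
  δ : Fin a → Fin b → ℕ
  δ i j = χ (lookup ⁅ f i ⁆ j)
  ∑δ≡1 : ∀ i → sum (δ i) ≡ 1
  ∑δ≡1 i = trans (≡.sym (∣p∣≡∑χ ⁅ f i ⁆)) (∣⁅x⁆∣≡1 (f i))

w≤push : ∀ {a b} (f : Fin a → Fin b) (w : Fin a → ℕ) i → w i ≤ push f w (f i)
w≤push f w i =
  ≤-trans (≤-reflexive wi≡term) (term≤∑ (λ i′ → χ (lookup ⁅ f i′ ⁆ (f i)) * w i′) i)
  where
  wi≡term : w i ≡ χ (lookup ⁅ f i ⁆ (f i)) * w i
  wi≡term = ≡.sym (trans (cong (λ b → χ b * w i) ([]=⇒lookup (x∈⁅x⁆ (f i)))) (*-identityˡ (w i)))

support : ∀ {n} → (Fin n → ℕ) → Subset n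
support w = tabulate (λ i → 0 <ᵇ w i)

∣support∣≡∑χ : ∀ {n} (w : Fin n → ℕ) → ∣ support w ∣ ≡ ∑[ i < n ] χ (0 <ᵇ w i)
∣support∣≡∑χ w = ∣tabulate∣≡∑χ (λ i → 0 <ᵇ w i)

∈-support : ∀ {n} (w : Fin n → ℕ) {i} → 1 ≤ w i → i ∈ support w
∈-support w {i} 1≤wi = ∈-tabulate (λ i′ → 0 <ᵇ w i′) (pos (w i) 1≤wi)
  where
  pos : ∀ a → 1 ≤ a → (0 <ᵇ a) ≡ true
  pos (suc a) _ = refl

χ-pos-+ : ∀ a c → χ (0 <ᵇ (a + c)) ≤ χ (0 <ᵇ a) + c
χ-pos-+ zero zero = z≤n
χ-pos-+ zero (suc c) = s≤s z≤n
χ-pos-+ (suc a) c = s≤s z≤n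

χ-pos≤ : ∀ a → χ (0 <ᵇ a) ≤ a
χ-pos≤ zero = z≤n
χ-pos≤ (suc a) = s≤s z≤n

χ-pos+1≤ : ∀ a → 2 ≤ a → χ (0 <ᵇ a) + 1 ≤ a
χ-pos+1≤ (suc (suc a)) _ = s≤s (s≤s z≤n)
χ-pos+1≤ (suc zero) (s≤s ())

∣support-+∣≤ : ∀ {n} (u v : Fin n → ℕ) →
  ∣ support (λ i → u i + v i) ∣ ≤ ∣ support u ∣ + sum v
∣support-+∣≤ u v = begin
  ∣ support (λ i → u i + v i) ∣     ≡⟨ ∣support∣≡∑χ (λ i → u i + v i) ⟩
  sum (λ i → χ (0 <ᵇ (u i + v i)))  ≤⟨ ∑-mono-≤ (λ i → χ-pos-+ (u i) (v i)) ⟩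
  sum (λ i → χ (0 <ᵇ u i) + v i)    ≡⟨ ∑-distrib-+ _ v ⟩
  sum (λ i → χ (0 <ᵇ u i)) + sum v  ≡⟨ cong (_+ sum v) (≡.sym (∣support∣≡∑χ u)) ⟩
  ∣ support u ∣ + sum v             ∎
  where open ≤-Reasoning

∣support∣+∑≤∑ : ∀ {n} (u v : Fin n → ℕ) → (∀ i → χ (0 <ᵇ u i) + v i ≤ u i) →
  ∣ support u ∣ + sum v ≤ sum u
∣support∣+∑≤∑ u v bound = begin
  ∣ support u ∣ + sum v             ≡⟨ cong (_+ sum v) (∣support∣≡∑χ u) ⟩
  sum (λ i → χ (0 <ᵇ u i)) + sum v  ≡⟨ ≡.sym (∑-distrib-+ _ v) ⟩
  sum (λ i → χ (0 <ᵇ u i) + v i)    ≤⟨ ∑-mono-≤ bound ⟩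
  sum u                             ∎
  where open ≤-Reasoning

¬¬-dec-∀ : ∀ {n} (P : Fin n → Set) → ¬ ¬ (∀ i → Dec (P i))
¬¬-dec-∀ {zero} P ¬dec = ¬dec (λ ())
¬¬-dec-∀ {suc n} P ¬dec = ¬¬-excluded-middle λ dec₀ → ¬¬-dec-∀ (P ∘ suc) λ dec₊ →
  ¬dec λ { zero → dec₀ ; (suc i) → dec₊ i }

neighbour : ∀ {n} (G : Graph n) → Nontrivial G → Connected G → ∀ u → ∃ (Adj G u)
neighbour G (s≤s (s≤s z≤n)) conn zero with conn zero (suc zero)
... | step u~v _ = _ , u~v
neighbour G (s≤s (s≤s z≤n)) conn (suc u) with conn (suc u) zero
... | step u~v _ = _ , u~v

dominating⇒isolating : ∀ {n} (G : Graph n) A → Dominating G A → Isolating G A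
dominating⇒isolating G A dom u _ u∉N[A] _ _ = u∉N[A] (dom u)

isolating⇒1≤∣∣ : ∀ {n} (G : Graph n) {u v S} → Adj G u v → Isolating G S → 1 ≤ ∣ S ∣
isolating⇒1≤∣∣ G {u} {v} {S} u~v iso with 1 ≤? ∣ S ∣
... | yes 1≤∣S∣ = 1≤∣S∣
... | no 1≰∣S∣ = ⊥-elim (iso u v outside outside u~v)
  where
  outside : ∀ {w} → ¬ InClosedNbhd G S w
  outside (inj₁ w∈S) = 1≰∣S∣ (∈⇒1≤∣∣ w∈S)
  outside (inj₂ (a , a∈S , _)) = 1≰∣S∣ (∈⇒1≤∣∣ a∈S)

-- With an edge present no isolating set is empty, so an isolating set of size ≤ 1 would realise ι.
isolating⇒2≤∣∣ : ∀ {n} (G : Graph n) → Nontrivial G → Connected G →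
  (∀ k → IsIsolationNumber G k → 2 ≤ k) → ∀ S → Isolating G S → 2 ≤ ∣ S ∣
isolating⇒2≤∣∣ G nt conn ι≥2 S iso with ∣ S ∣ in ∣S∣≡
... | zero with () ← ι≥2 0 ((S , iso , ∣S∣≡) , λ _ _ → z≤n)
... | suc zero with s≤s () ← ι≥2 1 ((S , iso , ∣S∣≡) , λ T →
  isolating⇒1≤∣∣ G (proj₂ (neighbour G nt conn (fromℕ< nt))))
... | suc (suc _) = s≤s (s≤s z≤n)

module Lexicographic {m n} (G : Graph m) (H : Graph n) where

  π₁ : Fin (m * n) → Fin m
  π₁ = quotient {m} n

  π₂ : Fin (m * n) → Fin n
  π₂ = remainder {m} n

  π₁-combine : ∀ (g : Fin m) (h : Fin n) → π₁ (combine g h) ≡ g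
  π₁-combine g h = cong proj₁ (remQuot-combine g h)

  π₂-combine : ∀ (g : Fin m) (h : Fin n) → π₂ (combine g h) ≡ h
  π₂-combine g h = cong proj₂ (remQuot-combine g h)

  combine-π : ∀ x → combine (π₁ x) (π₂ x) ≡ x
  combine-π = combine-remQuot {m} n

  adj-fibre : ∀ (g : Fin m) {u v} → Adj H u v → Adj (G ∘ₗ H) (combine g u) (combine g v)
  adj-fibre g {u} {v} u~v = inj₂ (trans (π₁-combine g u) (≡.sym (π₁-combine g v)) ,
    subst₂ (Adj H) (≡.sym (π₂-combine g u)) (≡.sym (π₂-combine g v)) u~v)

  adj-across : ∀ {g} h {y} → Adj G g (π₁ y) → Adj (G ∘ₗ H) (combine g h) y
  adj-across {g} h {y} g~y = inj₁ (subst (λ z → Adj G z (π₁ y)) (≡.sym (π₁-combine g h)) g~y)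

  fibre : Subset (m * n) → Fin m → Subset n
  fibre A g = tabulate (λ h → lookup A (combine g h))

  ∈-fibre : ∀ {A g h} → combine g h ∈ A → h ∈ fibre A g
  ∈-fibre {A} {g} c∈A = ∈-tabulate (λ h → lookup A (combine g h)) ([]=⇒lookup c∈A)

  π₂∈fibre : ∀ {A x} → x ∈ A → π₂ x ∈ fibre A (π₁ x)
  π₂∈fibre {A} {x} x∈A = ∈-fibre (subst (_∈ A) (≡.sym (combine-π x)) x∈A)

  ∣∣≡∑∣fibre∣ : ∀ A → ∣ A ∣ ≡ ∑[ g < m ] ∣ fibre A g ∣
  ∣∣≡∑∣fibre∣ A = begin
    ∣ A ∣                                            ≡⟨ ∣p∣≡∑χ A ⟩
    ∑[ x < m * n ] χ (lookup A x)                    ≡⟨ ∑-combine m n (χ ∘ lookup A) ⟩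
    ∑[ g < m ] ∑[ h < n ] χ (lookup A (combine g h)) ≡⟨ sum-cong-≗ {m} (λ g →
                                                          ∣tabulate∣≡∑χ (lookup A ∘ combine g)) ⟨
    ∑[ g < m ] ∣ fibre A g ∣                         ∎
    where open ≡-Reasoning

  _⊗_ : Subset m → Subset n → Subset (m * n)
  D ⊗ E = tabulate (λ x → lookup D (π₁ x) ∧ lookup E (π₂ x))

  lookup-⊗ : ∀ D E g h → lookup (D ⊗ E) (combine g h) ≡ lookup D g ∧ lookup E h
  lookup-⊗ D E g h = trans (lookup∘tabulate _ (combine g h))
    (cong₂ (λ g′ h′ → lookup D g′ ∧ lookup E h′) (π₁-combine g h) (π₂-combine g h))

  ∈-⊗ : ∀ {D E g h} → g ∈ D → h ∈ E → combine g h ∈ D ⊗ E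
  ∈-⊗ {D} {E} {g} {h} g∈D h∈E = lookup⇒[]= (combine g h) (D ⊗ E)
    (trans (lookup-⊗ D E g h) (cong₂ _∧_ ([]=⇒lookup g∈D) ([]=⇒lookup h∈E)))

  ∣fibre-⊗∣ : ∀ D E (g : Fin m) → ∣ fibre (D ⊗ E) g ∣ ≡ χ (lookup D g) * ∣ E ∣
  ∣fibre-⊗∣ D E g = begin
    ∣ fibre (D ⊗ E) g ∣                          ≡⟨ ∣tabulate∣≡∑χ (lookup (D ⊗ E) ∘ combine g) ⟩
    ∑[ h < n ] χ (lookup (D ⊗ E) (combine g h))  ≡⟨ sum-cong-≗ χ-⊗ ⟩
    ∑[ h < n ] (χ (lookup D g) * χ (lookup E h)) ≡⟨ *-distribˡ-sum (χ (lookup D g)) (χ ∘ lookup E) ⟨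
    χ (lookup D g) * ∑[ h < n ] χ (lookup E h)   ≡⟨ cong (χ (lookup D g) *_) (∣p∣≡∑χ E) ⟨
    χ (lookup D g) * ∣ E ∣                       ∎
    where
    open ≡-Reasoning
    χ-⊗ : ∀ h → χ (lookup (D ⊗ E) (combine g h)) ≡ χ (lookup D g) * χ (lookup E h)
    χ-⊗ h = trans (cong χ (lookup-⊗ D E g h)) (χ-∧ (lookup D g) (lookup E h))

  ∣⊗∣ : ∀ D E → ∣ D ⊗ E ∣ ≡ ∣ D ∣ * ∣ E ∣
  ∣⊗∣ D E = begin
    ∣ D ⊗ E ∣                           ≡⟨ ∣∣≡∑∣fibre∣ (D ⊗ E) ⟩
    ∑[ g < m ] ∣ fibre (D ⊗ E) g ∣      ≡⟨ sum-cong-≗ (∣fibre-⊗∣ D E) ⟩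
    ∑[ g < m ] (χ (lookup D g) * ∣ E ∣) ≡⟨ *-distribʳ-sum ∣ E ∣ (χ ∘ lookup D) ⟨
    (∑[ g < m ] χ (lookup D g)) * ∣ E ∣ ≡⟨ cong (_* ∣ E ∣) (∣p∣≡∑χ D) ⟨
    ∣ D ∣ * ∣ E ∣                       ∎
    where open ≡-Reasoning

  ⊗-dominating : ∀ {D E h} → TotalDominating G D → h ∈ E → Dominating (G ∘ₗ H) (D ⊗ E)
  ⊗-dominating {h = h} D-td h∈E y with D-td (π₁ y)
  ... | d , d∈D , d~y = inj₂ (combine d h , ∈-⊗ d∈D h∈E , adj-across h d~y)

  InProjectionNbhd : Subset (m * n) → Fin m → Set
  InProjectionNbhd A g = ∃ λ x → x ∈ A × Adj G (π₁ x) g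

  uncovered-fibre-isolating : ∀ {A g} → Isolating (G ∘ₗ H) A → ¬ InProjectionNbhd A g →
    Isolating H (fibre A g)
  uncovered-fibre-isolating {A} {g} iso g∉N u v u∉N v∉N u~v =
    iso (combine g u) (combine g v) (lift u∉N) (lift v∉N) (adj-fibre g u~v)
    where
    lift : ∀ {w} → ¬ InClosedNbhd H (fibre A g) w → ¬ InClosedNbhd (G ∘ₗ H) A (combine g w)
    lift w∉N (inj₁ c∈A) = w∉N (inj₁ (∈-fibre c∈A))
    lift {w} w∉N (inj₂ (x , x∈A , inj₁ x~c)) =
      g∉N (x , x∈A , subst (Adj G (π₁ x)) (π₁-combine g w) x~c)
    lift {w} w∉N (inj₂ (x , x∈A , inj₂ (π₁x≡ , x~c))) =
      w∉N (inj₂ (π₂ x , π₂x∈fibre , subst (Adj H (π₂ x)) (π₂-combine g w) x~c))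
      where
      π₂x∈fibre : π₂ x ∈ fibre A g
      π₂x∈fibre = subst (λ z → π₂ x ∈ fibre A z) (trans π₁x≡ (π₁-combine g w)) (π₂∈fibre x∈A)

  module Witness (A : Subset (m * n)) (dec : ∀ g → Dec (InProjectionNbhd A g)) (ν : Fin m → Fin m) where

    uncovered : Fin m → ℕ
    uncovered g = χ (not (does (dec g)))

    size : Fin m → ℕ
    size g = ∣ fibre A g ∣

    weight : Fin m → ℕ
    weight g = size g + push ν uncovered g

    witness : Subset m
    witness = support weight

    witness-totalDominating : (∀ g → Adj G g (ν g)) → TotalDominating G witness
    witness-totalDominating g~νg g with dec g in dec-g
    ... | yes (x , x∈A , x~g) =
      π₁ x , ∈-support weight (≤-trans (∈⇒1≤∣∣ (π₂∈fibre x∈A)) (m≤m+n _ _)) , x~g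
    ... | no _ = ν g , ∈-support weight (≤-trans 1≤push (m≤n+m _ _)) , Graph.sym G (g~νg g)
      where
      1≤push : 1 ≤ push ν uncovered (ν g)
      1≤push = ≤-trans (≤-reflexive (cong (χ ∘ not ∘ does) (≡.sym dec-g))) (w≤push ν uncovered g)

    ∣witness∣≤∣A∣ : (∀ g → ¬ InProjectionNbhd A g → 2 ≤ size g) → ∣ witness ∣ ≤ ∣ A ∣
    ∣witness∣≤∣A∣ uncovered⇒2≤ = begin
      ∣ witness ∣                                 ≤⟨ ∣support-+∣≤ size (push ν uncovered) ⟩
      ∣ support size ∣ + sum (push ν uncovered)   ≡⟨ cong (∣ support size ∣ +_) (∑-push ν uncovered) ⟩
      ∣ support size ∣ + sum uncovered            ≤⟨ ∣support∣+∑≤∑ size uncovered bound ⟩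
      sum size                                    ≡⟨ ∣∣≡∑∣fibre∣ A ⟨
      ∣ A ∣                                       ∎
      where
      open ≤-Reasoning
      bound : ∀ g → χ (0 <ᵇ size g) + uncovered g ≤ size g
      bound g with dec g
      ... | yes _ = ≤-trans (≤-reflexive (+-identityʳ _)) (χ-pos≤ _)
      ... | no uncovered-g = χ-pos+1≤ _ (uncovered⇒2≤ g uncovered-g)

  -- Deciding InProjectionNbhd is not constructive, but the goal k ≤ ∣ A ∣ is decidable, hence ¬¬-stable.
  γₜ≤∣isolating∣ : (∀ g → ∃ (Adj G g)) → (∀ S → Isolating H S → 2 ≤ ∣ S ∣) →
    ∀ {k} → (∀ D → TotalDominating G D → k ≤ ∣ D ∣) →
    ∀ A → Isolating (G ∘ₗ H) A → k ≤ ∣ A ∣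
  γₜ≤∣isolating∣ nbr ι≥2 {k} γₜ-min A iso = decidable-stable (k ≤? ∣ A ∣) λ k≰∣A∣ →
    ¬¬-dec-∀ (InProjectionNbhd A) λ dec → let open Witness A dec (proj₁ ∘ nbr) in
      k≰∣A∣ (≤-trans (γₜ-min witness (witness-totalDominating (proj₂ ∘ nbr)))
                     (∣witness∣≤∣A∣ λ g → ι≥2 (fibre A g) ∘ uncovered-fibre-isolating iso))

theorem4p2 : ∀ {m n} (G : Graph m) (H : Graph n) →
    Nontrivial G → Connected G → Nontrivial H → Connected H →
    (∀ k → IsIsolationNumber H k → 2 ≤ k) →
    ∀ k → IsTotalDominationNumber G k →
    IsIsolationNumber (G ∘ₗ H) k × IsDominationNumber (G ∘ₗ H) k
theorem4p2 {n = n} G H ntG connG ntH connH ι≥2 k ((D , D-td , ∣D∣≡k) , γₜ-min) =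
  ((D ⊗ E , dominating⇒isolating (G ∘ₗ H) _ D⊗E-dom , ∣D⊗E∣≡k) , lower) ,
  ((D ⊗ E , D⊗E-dom , ∣D⊗E∣≡k) , λ A → lower A ∘ dominating⇒isolating (G ∘ₗ H) A)
  where
  open Lexicographic G H
  h₀ : Fin n
  h₀ = fromℕ< ntH
  E : Subset n
  E = ⁅ h₀ ⁆
  D⊗E-dom : Dominating (G ∘ₗ H) (D ⊗ E)
  D⊗E-dom = ⊗-dominating D-td (x∈⁅x⁆ h₀)
  ∣D⊗E∣≡k : ∣ D ⊗ E ∣ ≡ k
  ∣D⊗E∣≡k = begin
    ∣ D ⊗ E ∣     ≡⟨ ∣⊗∣ D E ⟩
    ∣ D ∣ * ∣ E ∣ ≡⟨ cong (∣ D ∣ *_) (∣⁅x⁆∣≡1 h₀) ⟩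
    ∣ D ∣ * 1     ≡⟨ *-identityʳ ∣ D ∣ ⟩
    ∣ D ∣         ≡⟨ ∣D∣≡k ⟩
    k             ∎
    where open ≡-Reasoning
  lower : ∀ A → Isolating (G ∘ₗ H) A → k ≤ ∣ A ∣
  lower = γₜ≤∣isolating∣ (neighbour G ntG connG) (isolating⇒2≤∣∣ H ntH connH ι≥2) γₜ-min
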